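{- For every positive integer $q$, there exists a plane triangulation on $4q$ vertices in which all vertices have odd degree.
   Context: A plane triangulation is a simple planar graph embedded in the plane in which every face (including the outer one) is bounded by a triangle. -}

module Defs where

open import Data.Nat using (ℕ; zero; suc; _+_; _*_; _%_)
open import Data.Fin using (Fin; _≟_)
open import Data.List using (List; length; filter; allFin)
open import Data.Product using (Σ; ∃; ∃-syntax; _×_)
open import Relation.Nullary using (¬_)
open import Relation.Binary.PropositionalEquality using (_≡_)
open import Function.Definitions using (Injective)

iter : {A : Set} → (A → A) → ℕ → A → A
iter f zero    x = x
iter f (suc k) x = f (iter f k x)

-- A plane triangulation with vertex set Fin n, given combinatorially as a
-- rotation system (combinatorial map) on a set of darts Fin m:
--   * α pairs each dart with its reverse (fixed-point-free involution),
--     so edges = α-orbits;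
--   * vertex d = tail vertex of dart d;
--   * σ = rotation (cyclic order of darts around each vertex): a permutation
--     whose orbits are exactly the sets of darts at a common vertex;
--   * faces = orbits of φ = σ ∘ α; every face is a triangle;
--   * the underlying graph is simple and connected;
--   * Euler's formula V − E + F = 2 (genus 0, i.e. the embedding is in the
--     sphere/plane).
record PlaneTriangulation (n : ℕ) : Set where
  field
    m      : ℕ
    vertex : Fin m → Fin n
    α      : Fin m → Fin m
    σ      : Fin m → Fin m
    α-invol    : ∀ d → α (α d) ≡ d
    α-free     : ∀ d → ¬ (α d ≡ d)
    σ-perm     : Injective _≡_ _≡_ σ
    σ-orbits   : ∀ d d' → (vertex d ≡ vertex d') → ∃[ k ] (iter σ k d ≡ d')
    σ-vertex   : ∀ d → vertex (σ d) ≡ vertex d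
    vertex-surj : ∀ v → ∃[ d ] (vertex d ≡ v)
    no-loop    : ∀ d → ¬ (vertex (α d) ≡ vertex d)
    no-multi   : ∀ d d' → vertex d ≡ vertex d' → vertex (α d) ≡ vertex (α d') → d ≡ d'
    face-tri   : ∀ d → iter (λ x → σ (α x)) 3 d ≡ d
    face-nontriv : ∀ d → ¬ (σ (α d) ≡ d)
    connected  : ∀ u v → ∃[ k ] Σ (Fin (suc k) → Fin m) λ w →
                   (vertex (w Data.Fin.zero) ≡ u) ×
                   (vertex (α (w (Data.Fin.fromℕ k))) ≡ v) ×
                   (∀ (i : Fin k) → vertex (w (Data.Fin.suc i)) ≡ vertex (α (w (Data.Fin.inject₁ i))))
    -- Euler's formula: E edges (2E = #darts), F faces (3F = #darts), V − E + F = 2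
    edges faces : ℕ
    edges-def  : 2 * edges ≡ m
    faces-def  : 3 * faces ≡ m
    euler      : n + faces ≡ edges + 2

  degree : Fin n → ℕ
  degree v = length (filter (λ d → vertex d ≟ v) (allFin m))

AllOddDegree : {n : ℕ} → PlaneTriangulation n → Set
AllOddDegree {n} T = ∀ (v : Fin n) → PlaneTriangulation.degree T v % 2 ≡ 1

{-# OPTIONS --safe #-}
-- For q = 1 take the tetrahedron K₄, all of whose degrees are 3. For q ≥ 2 let k = 2q − 1 and
-- take the gyroelongated k-gonal bipyramid: an antiprism on two k-cycles A and B (A i is
-- joined to A (i ± 1), B i and B (i + 1)), with an apex N joined to every A i and an apex S
-- joined to every B j. It has 2k + 2 = 4q vertices; the apexes have odd degree k and all
-- other vertices have degree 5.
module Submission where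

open import Defs
open import Data.Bool using (Bool; true; false; if_then_else_)
open import Data.Fin using (Fin; zero; suc; toℕ; fromℕ; inject₁; _↑ˡ_; _↑ʳ_; splitAt; _≟_; cast)
open import Data.Fin.Patterns using (0F; 1F; 2F; 3F; 4F)
open import Data.Fin.Properties
  using (all?; toℕ-fromℕ<; toℕ-injective; toℕ<n; splitAt-↑ˡ; splitAt-↑ʳ; splitAt⁻¹-↑ˡ; splitAt⁻¹-↑ʳ;
         cast-is-id; cast-involutive)
open import Data.List using (length; filter; tabulate)
open import Data.Nat using (ℕ; zero; suc; _+_; _*_; _%_; _<_; _≤_; z≤n; s≤s)
open import Data.Nat.DivMod using (_mod_; %-distribˡ-+; m%n%n≡m%n; [m+n]%n≡m%n; [m+kn]%n≡m%n; m<n⇒m%n≡m)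
open import Data.Nat.Properties
  using (≤-trans; +-comm; +-assoc; +-identityʳ; *-identityʳ; *-zeroʳ; <-irrefl; n<1+n; +-0-monoid)
open import Data.Nat.Tactic.RingSolver using (solve-∀)
open import Algebra.Properties.Monoid.Sum +-0-monoid using (sum; sum-cong-≗)
open import Data.Product using (Σ; ∃-syntax; _×_; _,_; proj₁; proj₂; map)
open import Data.Product.Properties using (Σ-≡,≡←≡; ≡-dec)
open import Data.Sum using (inj₁; inj₂; [_,_]′)
import Data.Vec.Functional as Vector
open import Function using (_∘_; id)
open import Function.Bundles using (_↔_; Inverse; mk↔ₛ′)
open import Function.Consequences.Propositional using (inverseʳ⇒injective; strictlyInverseʳ⇒inverseʳ)
open import Function.Construct.Identity using (↔-id)
open import Function.Definitions using (Injective; StrictlyInverseʳ)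
open import Relation.Binary.Construct.Closure.Transitive using (TransClosure; [_]; _∷_; _++_; symmetric)
open import Relation.Binary.Definitions using (DecidableEquality)
open import Relation.Binary.PropositionalEquality
open import Relation.Nullary using (Dec; does; ¬?)
open import Relation.Nullary.Decidable using (map′; from-yes; _→-dec_; dec-true; dec-false)
open import Relation.Unary using (Pred; Decidable)

strictlyInverseʳ⇒injective : {A B : Set} {f : A → B} (g : B → A) →
                             StrictlyInverseʳ _≡_ f g → Injective _≡_ _≡_ f
strictlyInverseʳ⇒injective {f = f} g g∘f≗id =
  inverseʳ⇒injective f (strictlyInverseʳ⇒inverseʳ {f⁻¹ = g} f g∘f≗id)

iter-sucʳ : {A : Set} (f : A → A) (t : ℕ) (x : A) → iter f (suc t) x ≡ iter f t (f x)
iter-sucʳ f zero    x = refl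
iter-sucʳ f (suc t) x = cong f (iter-sucʳ f t x)

iter-semiconj : {A B : Set} {h : A → B} {g : A → A} {f : B → B} →
                (∀ x → h (g x) ≡ f (h x)) → ∀ t x → h (iter g t x) ≡ iter f t (h x)
iter-semiconj         h∘g≗f∘h zero    x = refl
iter-semiconj {f = f} h∘g≗f∘h (suc t) x = trans (h∘g≗f∘h _) (cong f (iter-semiconj h∘g≗f∘h t x))

iter-cancel : {A : Set} {f g : A → A} → StrictlyInverseʳ _≡_ f g →
              ∀ t x → iter g t (iter f t x) ≡ x
iter-cancel             g∘f≗id zero    x = refl
iter-cancel {f = f} {g} g∘f≗id (suc t) x = begin
  iter g (suc t) (f (iter f t x))  ≡⟨ iter-sucʳ g t _ ⟩
  iter g t (g (f (iter f t x)))    ≡⟨ cong (iter g t) (g∘f≗id _) ⟩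
  iter g t (iter f t x)            ≡⟨ iter-cancel g∘f≗id t x ⟩
  x                                ∎
  where open ≡-Reasoning

module Cyclic (K : ℕ) where

  private
    k : ℕ
    k = suc K

  infixl 6 _⊕_
  _⊕_ : Fin k → ℕ → Fin k
  i ⊕ t = (toℕ i + t) mod k

  toℕ-⊕ : ∀ i t → toℕ (i ⊕ t) ≡ (toℕ i + t) % k
  toℕ-⊕ i t = toℕ-fromℕ< _

  toℕ%k≡toℕ : ∀ (i : Fin k) → toℕ i % k ≡ toℕ i
  toℕ%k≡toℕ i = m<n⇒m%n≡m (toℕ<n i)

  [m%k+n]%k≡[m+n]%k : ∀ m n → (m % k + n) % k ≡ (m + n) % k
  [m%k+n]%k≡[m+n]%k m n = begin
    (m % k + n) % k          ≡⟨ %-distribˡ-+ (m % k) n k ⟩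
    (m % k % k + n % k) % k  ≡⟨ cong (λ x → (x + n % k) % k) (m%n%n≡m%n m k) ⟩
    (m % k + n % k) % k      ≡⟨ %-distribˡ-+ m n k ⟨
    (m + n) % k              ∎
    where open ≡-Reasoning

  ⊕-assoc : ∀ i a b → i ⊕ a ⊕ b ≡ i ⊕ (a + b)
  ⊕-assoc i a b = toℕ-injective (begin
    toℕ (i ⊕ a ⊕ b)            ≡⟨ toℕ-⊕ (i ⊕ a) b ⟩
    (toℕ (i ⊕ a) + b) % k       ≡⟨ cong (λ x → (x + b) % k) (toℕ-⊕ i a) ⟩
    ((toℕ i + a) % k + b) % k   ≡⟨ [m%k+n]%k≡[m+n]%k (toℕ i + a) b ⟩
    (toℕ i + a + b) % k         ≡⟨ cong (_% k) (+-assoc (toℕ i) a b) ⟩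
    (toℕ i + (a + b)) % k       ≡⟨ toℕ-⊕ i (a + b) ⟨
    toℕ (i ⊕ (a + b))           ∎)
    where open ≡-Reasoning

  ⊕-⊕-comm : ∀ i a b → i ⊕ a ⊕ b ≡ i ⊕ b ⊕ a
  ⊕-⊕-comm i a b = trans (⊕-assoc i a b) (trans (cong (i ⊕_) (+-comm a b)) (sym (⊕-assoc i b a)))

  ⊕-identityʳ : ∀ i → i ⊕ 0 ≡ i
  ⊕-identityʳ i = toℕ-injective (trans (toℕ-⊕ i 0) (trans (cong (_% k) (+-identityʳ (toℕ i))) (toℕ%k≡toℕ i)))

  ⊕-period : ∀ i → i ⊕ k ≡ i
  ⊕-period i = toℕ-injective (trans (toℕ-⊕ i k) (trans ([m+n]%n≡m%n (toℕ i) k) (toℕ%k≡toℕ i)))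

  ⊕-reach : ∀ i j → ∃[ t ] i ⊕ t ≡ j
  ⊕-reach i j = toℕ j + toℕ i * K , toℕ-injective (begin
    toℕ (i ⊕ (toℕ j + toℕ i * K))      ≡⟨ toℕ-⊕ i _ ⟩
    (toℕ i + (toℕ j + toℕ i * K)) % k  ≡⟨ cong (_% k) (rearrange (toℕ i) (toℕ j) K) ⟩
    (toℕ j + toℕ i * k) % k            ≡⟨ [m+kn]%n≡m%n (toℕ j) (toℕ i) k ⟩
    toℕ j % k                          ≡⟨ toℕ%k≡toℕ j ⟩
    toℕ j                              ∎)
    where
      open ≡-Reasoning
      rearrange : ∀ x y K → x + (y + x * K) ≡ y + x * suc K
      rearrange = solve-∀

  ⊕-≢ : ∀ i {c} → 0 < c → c < k → i ⊕ c ≢ i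
  ⊕-≢ i {c} 0<c c<k i⊕c≡i with ⊕-reach i zero
  ... | u , i⊕u≡0 = <-irrefl (sym c≡0) 0<c
    where
      0⊕c≡0 : zero ⊕ c ≡ zero
      0⊕c≡0 = begin
        zero ⊕ c   ≡⟨ cong (_⊕ c) i⊕u≡0 ⟨
        i ⊕ u ⊕ c  ≡⟨ ⊕-⊕-comm i u c ⟩
        i ⊕ c ⊕ u  ≡⟨ cong (_⊕ u) i⊕c≡i ⟩
        i ⊕ u      ≡⟨ i⊕u≡0 ⟩
        zero       ∎
        where open ≡-Reasoning
      c≡0 : c ≡ 0
      c≡0 = trans (sym (m<n⇒m%n≡m c<k)) (trans (sym (toℕ-⊕ zero c)) (cong toℕ 0⊕c≡0))

  infixl 7 _⁺ _⁻
  _⁺ _⁻ : Fin k → Fin k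
  i ⁺ = i ⊕ 1
  i ⁻ = i ⊕ K

  ⁺⁻ : ∀ i → i ⁺ ⁻ ≡ i
  ⁺⁻ i = trans (⊕-assoc i 1 K) (⊕-period i)

  ⁻⁺ : ∀ i → i ⁻ ⁺ ≡ i
  ⁻⁺ i = trans (⊕-⊕-comm i K 1) (⁺⁻ i)

  ⁺-injective : Injective _≡_ _≡_ _⁺
  ⁺-injective = strictlyInverseʳ⇒injective _⁻ ⁺⁻

  ⁻-injective : Injective _≡_ _≡_ _⁻
  ⁻-injective = strictlyInverseʳ⇒injective _⁺ ⁻⁺

  iter-⁺ : ∀ t i → iter _⁺ t i ≡ i ⊕ t
  iter-⁺ zero    i = sym (⊕-identityʳ i)
  iter-⁺ (suc t) i = trans (cong _⁺ (iter-⁺ t i)) (trans (⊕-assoc i t 1) (cong (i ⊕_) (+-comm t 1)))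

  ⁺-cyclic : ∀ i j → ∃[ t ] iter _⁺ t i ≡ j
  ⁺-cyclic i j = let t , i⊕t≡j = ⊕-reach i j in t , trans (iter-⁺ t i) i⊕t≡j

  ⁻-cyclic : ∀ i j → ∃[ t ] iter _⁻ t i ≡ j
  ⁻-cyclic i j = let t , j⁺ᵗ≡i = ⁺-cyclic j i in
    t , trans (cong (iter _⁻ t) (sym j⁺ᵗ≡i)) (iter-cancel ⁺⁻ t j)

  ⁺-≢ : 1 ≤ K → ∀ i → i ⁺ ≢ i
  ⁺-≢ 1≤K i = ⊕-≢ i (s≤s z≤n) (s≤s 1≤K)

  ⁻-≢ : 1 ≤ K → ∀ i → i ⁻ ≢ i
  ⁻-≢ 1≤K i = ⊕-≢ i 1≤K (n<1+n K)

  ⁻-≢-⁺ : 2 ≤ K → ∀ i → i ⁻ ≢ i ⁺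
  ⁻-≢-⁺ 2≤K i i⁻≡i⁺ = ⊕-≢ i (s≤s z≤n) (s≤s 2≤K) (sym (begin
    i      ≡⟨ ⁻⁺ i ⟨
    i ⁻ ⁺  ≡⟨ cong _⁺ i⁻≡i⁺ ⟩
    i ⁺ ⁺  ≡⟨ ⊕-assoc i 1 1 ⟩
    i ⊕ 2  ∎))
    where open ≡-Reasoning

sum-const : ∀ n c → sum {n} (λ _ → c) ≡ n * c
sum-const zero    c = refl
sum-const (suc n) c = cong (c +_) (sum-const n c)

sum-split : ∀ m {n} (f : Fin (m + n) → ℕ) → sum f ≡ sum (f ∘ (_↑ˡ n)) + sum (f ∘ (m ↑ʳ_))
sum-split zero    f = refl
sum-split (suc m) f = trans (cong (f zero +_) (sum-split m (f ∘ suc))) (sym (+-assoc (f zero) _ _))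

count : ∀ {n} → (Fin n → Bool) → ℕ
count b = sum (λ i → if b i then 1 else 0)

count-cong : ∀ {n} {b c : Fin n → Bool} → (∀ i → b i ≡ c i) → count b ≡ count c
count-cong b≗c = sum-cong-≗ (λ i → cong (λ x → if x then 1 else 0) (b≗c i))

count-true : ∀ n → count {n} (λ _ → true) ≡ n
count-true n = trans (sum-const n 1) (*-identityʳ n)

count-false : ∀ n → count {n} (λ _ → false) ≡ 0
count-false n = trans (sum-const n 0) (*-zeroʳ n)

length-filter-tabulate : ∀ {A : Set} {p} {P : Pred A p} (P? : Decidable P) {n} (g : Fin n → A) →
                         length (filter P? (tabulate g)) ≡ count (λ i → does (P? (g i)))
length-filter-tabulate P? {zero}  g = refl
length-filter-tabulate P? {suc n} g with does (P? (g zero))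
... | true  = cong suc (length-filter-tabulate P? (g ∘ suc))
... | false = length-filter-tabulate P? (g ∘ suc)

flatten : ∀ {n} (f : Fin n → ℕ) → Σ (Fin n) (Fin ∘ f) → Fin (sum f)
flatten f (zero  , s) = s ↑ˡ _
flatten f (suc i , s) = f zero ↑ʳ flatten (f ∘ suc) (i , s)

unflatten : ∀ {n} (f : Fin n → ℕ) → Fin (sum f) → Σ (Fin n) (Fin ∘ f)
unflatten {suc n} f d = [ zero ,_ , map suc id ∘ unflatten (f ∘ suc) ]′ (splitAt (f zero) d)

unflatten-flatten : ∀ {n} (f : Fin n → ℕ) x → unflatten f (flatten f x) ≡ x
unflatten-flatten f (zero , s)
  rewrite splitAt-↑ˡ (f zero) s (sum (f ∘ suc)) = refl
unflatten-flatten f (suc i , s)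
  rewrite splitAt-↑ʳ (f zero) (sum (f ∘ suc)) (flatten (f ∘ suc) (i , s))
  = cong (map suc id) (unflatten-flatten (f ∘ suc) (i , s))

flatten-unflatten : ∀ {n} (f : Fin n → ℕ) d → flatten f (unflatten f d) ≡ d
flatten-unflatten {suc n} f d with splitAt (f zero) d in eq
... | inj₁ s = splitAt⁻¹-↑ˡ eq
... | inj₂ r = trans (cong (f zero ↑ʳ_) (flatten-unflatten (f ∘ suc) r)) (splitAt⁻¹-↑ʳ eq)

private
  count-unflatten-suc : ∀ {n} (f : Fin (suc n) → ℕ) i →
    count (λ d → does (proj₁ (unflatten f d) ≟ i)) ≡
    count {f zero} (λ _ → does (zero ≟ i)) + count (λ r → does (suc (proj₁ (unflatten (f ∘ suc) r)) ≟ i))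
  count-unflatten-suc f i = trans (sum-split (f zero) _)
    (cong₂ _+_ (count-cong (λ s → cong (λ j → does (j ≟ i)) (cong proj₁ (unflatten-flatten f (zero , s)))))
               (count-cong (λ r → cong (λ j → does (j ≟ i)) (index-↑ʳ r))))
    where
      index-↑ʳ : ∀ r → proj₁ (unflatten f (f zero ↑ʳ r)) ≡ suc (proj₁ (unflatten (f ∘ suc) r))
      index-↑ʳ r rewrite splitAt-↑ʳ (f zero) (sum (f ∘ suc)) r = refl

count-unflatten : ∀ {n} (f : Fin n → ℕ) i → count (λ d → does (proj₁ (unflatten f d) ≟ i)) ≡ f i
count-unflatten f zero    = trans (count-unflatten-suc f zero)
  (trans (cong₂ _+_ (count-true (f zero)) (count-false (sum (f ∘ suc)))) (+-identityʳ (f zero)))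
count-unflatten f (suc j) = trans (count-unflatten-suc f (suc j))
  (cong₂ _+_ (count-false (f zero)) (count-unflatten (f ∘ suc) j))

Σ-cast : {A : Set} (g : A → ℕ) {a b : A} (a≡b : a ≡ b) (s : Fin (g a)) →
         _≡_ {A = Σ A (Fin ∘ g)} (a , s) (b , cast (cong g a≡b) s)
Σ-cast g refl s = cong (_ ,_) (sym (cast-is-id refl s))

Dart : {V : Set} → (V → ℕ) → Set
Dart {V} deg = Σ V (Fin ∘ deg)

module RotationSystem {V : Set} {deg : V → ℕ}
                      (ρ : ∀ v → Fin (deg v) → Fin (deg v))
                      (α : Dart deg → Dart deg) where

  σ : Dart deg → Dart deg
  σ (v , s) = v , ρ v s

  _~_ : V → V → Set
  u ~ v = ∃[ s ] proj₁ (α (u , s)) ≡ v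

  record IsTriangulation : Set where
    field
      ρ-injective         : ∀ v → Injective _≡_ _≡_ (ρ v)
      ρ-cyclic            : ∀ v s t → ∃[ k ] iter (ρ v) k s ≡ t
      α-involutive        : ∀ x → α (α x) ≡ x
      loopless            : ∀ x → proj₁ (α x) ≢ proj₁ x
      neighbour-injective : ∀ v → Injective _≡_ _≡_ (λ s → proj₁ (α (v , s)))
      triangular          : ∀ x → iter (σ ∘ α) 3 x ≡ x
      hub                 : V
      hub-reachable       : ∀ v → TransClosure _~_ v hub

    σ-injective : Injective _≡_ _≡_ σ
    σ-injective {v , s} {w , t} σ[v,s]≡σ[w,t] with Σ-≡,≡←≡ σ[v,s]≡σ[w,t]
    ... | refl , ρvs≡ρvt = cong (v ,_) (ρ-injective v ρvs≡ρvt)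

    σ-cyclic : ∀ x y → proj₁ x ≡ proj₁ y → ∃[ k ] iter σ k x ≡ y
    σ-cyclic (v , s) (.v , t) refl = let k , ρᵏs≡t = ρ-cyclic v s t in
      k , trans (sym (iter-semiconj {h = v ,_} (λ _ → refl) k s)) (cong (v ,_) ρᵏs≡t)

    simple : ∀ x y → proj₁ x ≡ proj₁ y → proj₁ (α x) ≡ proj₁ (α y) → x ≡ y
    simple (v , s) (.v , t) refl αs≡αt = cong (v ,_) (neighbour-injective v αs≡αt)

    ~-sym : ∀ {u v} → u ~ v → v ~ u
    ~-sym {u} (s , refl) = proj₂ (α (u , s)) , cong proj₁ (α-involutive (u , s))

    some-dart : ∀ v → Fin (deg v)
    some-dart v with hub-reachable v
    ... | [ s , _ ]   = s
    ... | (s , _) ∷ _ = s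

  module Plane (T : IsTriangulation) {t : ℕ} (enum : V ↔ Fin (2 + t))
               (degree-sum : sum (deg ∘ Inverse.from enum) ≡ 6 * t) where

    open IsTriangulation T
    open Inverse enum using (to; from; strictlyInverseˡ; strictlyInverseʳ)

    m : ℕ
    m = sum (deg ∘ from)

    vertex : Fin m → Fin (2 + t)
    vertex d = proj₁ (unflatten (deg ∘ from) d)

    -- cast rather than subst: its equality argument is irrelevant, so the round trips below need
    -- no coherence between the two inverse laws of enum.
    encode : Dart deg → Fin m
    encode (v , s) = flatten (deg ∘ from) (to v , cast (cong deg (sym (strictlyInverseʳ v))) s)

    decode : Fin m → Dart deg
    decode d = map from id (unflatten (deg ∘ from) d)

    decode-encode : ∀ x → decode (encode x) ≡ x
    decode-encode (v , s) =
      trans (cong (map from id) (unflatten-flatten (deg ∘ from) _))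
            (trans (Σ-cast deg (strictlyInverseʳ v) _)
                   (cong (v ,_) (cast-involutive {m = deg (from (to v))} _ _ s)))

    encode-decode : ∀ d → encode (decode d) ≡ d
    encode-decode d =
      trans (cong (flatten (deg ∘ from))
                  (trans (Σ-cast (deg ∘ from) (strictlyInverseˡ i) _)
                         (cong (i ,_) (cast-involutive {m = deg (from (to (from i)))} _ _ s))))
            (flatten-unflatten (deg ∘ from) d)
      where
        i : Fin (2 + t)
        i = proj₁ (unflatten (deg ∘ from) d)
        s : Fin (deg (from i))
        s = proj₂ (unflatten (deg ∘ from) d)

    decode-injective : Injective _≡_ _≡_ decode
    decode-injective = strictlyInverseʳ⇒injective encode encode-decode

    from-injective : Injective _≡_ _≡_ from
    from-injective = strictlyInverseʳ⇒injective to strictlyInverseˡ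

    vertex-encode : ∀ x → vertex (encode x) ≡ to (proj₁ x)
    vertex-encode (v , s) = cong proj₁ (unflatten-flatten (deg ∘ from) _)

    α′ σ′ : Fin m → Fin m
    α′ d = encode (α (decode d))
    σ′ d = encode (σ (decode d))

    decode-α′ : ∀ d → decode (α′ d) ≡ α (decode d)
    decode-α′ d = decode-encode (α (decode d))

    decode-σ′ : ∀ d → decode (σ′ d) ≡ σ (decode d)
    decode-σ′ d = decode-encode (σ (decode d))

    decode-σ′α′ : ∀ d → decode (σ′ (α′ d)) ≡ σ (α (decode d))
    decode-σ′α′ d = trans (decode-σ′ (α′ d)) (cong σ (decode-α′ d))

    vertex-α′-encode : ∀ x → vertex (α′ (encode x)) ≡ to (proj₁ (α x))
    vertex-α′-encode x = trans (vertex-encode (α (decode (encode x)))) (cong (to ∘ proj₁ ∘ α) (decode-encode x))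

    Walk : Fin (2 + t) → Fin (2 + t) → Set
    Walk u v = ∃[ k ] Σ (Fin (suc k) → Fin m) λ w →
                 (vertex (w zero) ≡ u) ×
                 (vertex (α′ (w (fromℕ k))) ≡ v) ×
                 (∀ (i : Fin k) → vertex (w (suc i)) ≡ vertex (α′ (w (inject₁ i))))

    walk : ∀ {u v} → TransClosure _~_ u v → Walk (to u) (to v)
    walk {u} [ s , refl ] =
      0 , (λ _ → encode (u , s)) , vertex-encode (u , s) , vertex-α′-encode (u , s) , λ ()
    walk {u} ((s , refl) ∷ path) with walk path
    ... | k , w , start , end , steps = suc k , encode (u , s) Vector.∷ w , vertex-encode (u , s) , end , λ where
      zero    → trans start (sym (vertex-α′-encode (u , s)))
      (suc i) → steps i

    connected : ∀ u v → Walk u v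
    connected u v = subst₂ Walk (strictlyInverseˡ u) (strictlyInverseˡ v)
      (walk (hub-reachable (from u) ++ symmetric _~_ ~-sym (hub-reachable (from v))))

    -- 2E = 3F = m = 6t gives E = 3t and F = 2t, and then V − E + F = 2.
    plane : PlaneTriangulation (2 + t)
    plane = record
      { m            = m
      ; vertex       = vertex
      ; α            = α′
      ; σ            = σ′
      ; α-invol      = λ d → decode-injective
                         (trans (decode-α′ (α′ d)) (trans (cong α (decode-α′ d)) (α-involutive (decode d))))
      ; α-free       = λ d α′d≡d → loopless (decode d)
                         (cong proj₁ (trans (sym (decode-α′ d)) (cong decode α′d≡d)))
      ; σ-perm       = λ σ′d≡σ′d′ → decode-injective
                         (σ-injective (trans (sym (decode-σ′ _)) (trans (cong decode σ′d≡σ′d′) (decode-σ′ _))))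
      ; σ-orbits     = λ d d′ vd≡vd′ → let k , σᵏd≡d′ = σ-cyclic (decode d) (decode d′) (cong from vd≡vd′) in
                         k , decode-injective (trans (iter-semiconj decode-σ′ k d) σᵏd≡d′)
      ; σ-vertex     = λ d → from-injective (cong proj₁ (decode-σ′ d))
      ; vertex-surj  = λ v → encode (from v , some-dart (from v)) , trans (vertex-encode _) (strictlyInverseˡ v)
      ; no-loop      = λ d vα′d≡vd → loopless (decode d)
                         (trans (sym (cong proj₁ (decode-α′ d))) (cong from vα′d≡vd))
      ; no-multi     = λ d d′ vd≡vd′ vα′d≡vα′d′ → decode-injective (simple (decode d) (decode d′) (cong from vd≡vd′)
                         (trans (sym (cong proj₁ (decode-α′ d)))
                                (trans (cong from vα′d≡vα′d′) (cong proj₁ (decode-α′ d′)))))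
      ; face-tri     = λ d → decode-injective
                         (trans (iter-semiconj {h = decode} {f = σ ∘ α} decode-σ′α′ 3 d) (triangular (decode d)))
      ; face-nontriv = λ d σ′α′d≡d → loopless (decode d)
                         (cong proj₁ (trans (sym (decode-σ′α′ d)) (cong decode σ′α′d≡d)))
      ; connected    = connected
      ; edges        = 3 * t
      ; faces        = 2 * t
      ; edges-def    = trans (twice-edges t) (sym degree-sum)
      ; faces-def    = trans (thrice-faces t) (sym degree-sum)
      ; euler        = euler t
      }
      where
        twice-edges : ∀ t → 2 * (3 * t) ≡ 6 * t
        twice-edges = solve-∀
        thrice-faces : ∀ t → 3 * (2 * t) ≡ 6 * t
        thrice-faces = solve-∀
        euler : ∀ t → 2 + t + 2 * t ≡ 3 * t + 2
        euler = solve-∀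

    degree-plane : ∀ i → PlaneTriangulation.degree plane i ≡ deg (from i)
    degree-plane i = trans (length-filter-tabulate (λ d → vertex d ≟ i) id) (count-unflatten (deg ∘ from) i)

    allOddDegree : (∀ v → deg v % 2 ≡ 1) → AllOddDegree plane
    allOddDegree odd i = trans (cong (_% 2) (degree-plane i)) (odd (from i))

module K₄ where

  open Cyclic 2 using (_⁺; ⁺-injective; ⁺-cyclic)

  deg : Fin 4 → ℕ
  deg _ = 3

  ρ : ∀ v → Fin (deg v) → Fin (deg v)
  ρ _ = _⁺

  α : Dart deg → Dart deg
  α (0F , 0F) = 1F , 0F
  α (0F , 1F) = 2F , 0F
  α (0F , 2F) = 3F , 0F
  α (1F , 0F) = 0F , 0F
  α (1F , 1F) = 3F , 2F
  α (1F , 2F) = 2F , 1F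
  α (2F , 0F) = 0F , 1F
  α (2F , 1F) = 1F , 2F
  α (2F , 2F) = 3F , 1F
  α (3F , 0F) = 0F , 2F
  α (3F , 1F) = 2F , 2F
  α (3F , 2F) = 1F , 1F

  open RotationSystem ρ α

  ∀-dart? : {P : Dart deg → Set} → Decidable P → Dec (∀ x → P x)
  ∀-dart? P? = map′ (λ P[v,s] (v , s) → P[v,s] v s) (λ P[x] v s → P[x] (v , s))
                    (all? λ v → all? λ s → P? (v , s))

  _≟ᵈ_ : DecidableEquality (Dart deg)
  _≟ᵈ_ = ≡-dec _≟_ _≟_

  isTriangulation : IsTriangulation
  isTriangulation = record
    { ρ-injective         = λ _ → ⁺-injective
    ; ρ-cyclic            = λ _ → ⁺-cyclic
    ; α-involutive        = from-yes (∀-dart? λ x → α (α x) ≟ᵈ x)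
    ; loopless            = from-yes (∀-dart? λ x → ¬? (proj₁ (α x) ≟ proj₁ x))
    ; neighbour-injective = λ v {s} {t} → from-yes (all? λ v → all? λ s → all? λ t →
                              (proj₁ (α (v , s)) ≟ proj₁ (α (v , t))) →-dec (s ≟ t)) v s t
    ; triangular          = from-yes (∀-dart? λ x → iter (σ ∘ α) 3 x ≟ᵈ x)
    ; hub                 = 0F
    ; hub-reachable       = λ where
        0F → (0F , refl) ∷ [ 0F , refl ]
        1F → [ 0F , refl ]
        2F → [ 0F , refl ]
        3F → [ 0F , refl ]
    }

  open Plane isTriangulation (↔-id (Fin 4)) refl using (plane; allOddDegree)

  k₄ : Σ (PlaneTriangulation 4) AllOddDegree
  k₄ = plane , allOddDegree λ _ → refl

module GyroelongatedBipyramid (K : ℕ) (2≤K : 2 ≤ K) where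

  open Cyclic K using (_⁺; _⁻; ⁺⁻; ⁻⁺; ⁺-injective; ⁻-injective; ⁺-cyclic; ⁻-cyclic; ⁺-≢; ⁻-≢; ⁻-≢-⁺)
  module ℤ₅ = Cyclic 4

  k : ℕ
  k = suc K

  data Vertex : Set where
    N S : Vertex
    A B : Fin k → Vertex

  A-injective : ∀ {i j} → A i ≡ A j → i ≡ j
  A-injective refl = refl

  B-injective : ∀ {i j} → B i ≡ B j → i ≡ j
  B-injective refl = refl

  deg : Vertex → ℕ
  deg N     = k
  deg S     = k
  deg (A _) = 5
  deg (B _) = 5

  -- Seen from N, the B-ring lies on the far side of the sphere, so S turns the other way.
  ρ : ∀ v → Fin (deg v) → Fin (deg v)
  ρ N     = _⁺
  ρ S     = _⁻
  ρ (A _) = ℤ₅._⁺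
  ρ (B _) = ℤ₅._⁺

  α : Dart deg → Dart deg
  α (N   , j)  = A j     , 0F
  α (S   , j)  = B j     , 0F
  α (A i , 0F) = N       , i
  α (A i , 1F) = A (i ⁻) , 4F
  α (A i , 2F) = B i     , 2F
  α (A i , 3F) = B (i ⁺) , 3F
  α (A i , 4F) = A (i ⁺) , 1F
  α (B j , 0F) = S       , j
  α (B j , 1F) = B (j ⁺) , 4F
  α (B j , 2F) = A j     , 2F
  α (B j , 3F) = A (j ⁻) , 3F
  α (B j , 4F) = B (j ⁻) , 1F

  open RotationSystem ρ α

  α-involutive : ∀ x → α (α x) ≡ x
  α-involutive (N   , j)  = refl
  α-involutive (S   , j)  = refl
  α-involutive (A i , 0F) = refl
  α-involutive (A i , 1F) = cong (λ i → A i , 1F) (⁻⁺ i)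
  α-involutive (A i , 2F) = refl
  α-involutive (A i , 3F) = cong (λ i → A i , 3F) (⁺⁻ i)
  α-involutive (A i , 4F) = cong (λ i → A i , 4F) (⁺⁻ i)
  α-involutive (B j , 0F) = refl
  α-involutive (B j , 1F) = cong (λ j → B j , 1F) (⁺⁻ j)
  α-involutive (B j , 2F) = refl
  α-involutive (B j , 3F) = cong (λ j → B j , 3F) (⁻⁺ j)
  α-involutive (B j , 4F) = cong (λ j → B j , 4F) (⁻⁺ j)

  1≤K : 1 ≤ K
  1≤K = ≤-trans (s≤s z≤n) 2≤K

  loopless : ∀ x → proj₁ (α x) ≢ proj₁ x
  loopless (N   , j)  ()
  loopless (S   , j)  ()
  loopless (A i , 0F) ()
  loopless (A i , 1F) = ⁻-≢ 1≤K i ∘ A-injective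
  loopless (A i , 2F) ()
  loopless (A i , 3F) ()
  loopless (A i , 4F) = ⁺-≢ 1≤K i ∘ A-injective
  loopless (B j , 0F) ()
  loopless (B j , 1F) = ⁺-≢ 1≤K j ∘ B-injective
  loopless (B j , 2F) ()
  loopless (B j , 3F) ()
  loopless (B j , 4F) = ⁻-≢ 1≤K j ∘ B-injective

  -- A left inverse of the neighbour map at v; its values at non-neighbours of v are arbitrary.
  slot : ∀ v → Vertex → Fin (deg v)
  slot N     (A j) = j
  slot N     _     = zero
  slot S     (B j) = j
  slot S     _     = zero
  slot (A i) (A j) = if does (j ≟ i ⁻) then 1F else 4F
  slot (A i) (B j) = if does (j ≟ i) then 2F else 3F
  slot (A i) _     = 0F
  slot (B j) (B l) = if does (l ≟ j ⁺) then 1F else 4F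
  slot (B j) (A l) = if does (l ≟ j) then 2F else 3F
  slot (B j) _     = 0F

  slot-α : ∀ v s → slot v (proj₁ (α (v , s))) ≡ s
  slot-α N     j  = refl
  slot-α S     j  = refl
  slot-α (A i) 0F = refl
  slot-α (A i) 1F = cong (λ b → if b then 1F else 4F) (dec-true (i ⁻ ≟ i ⁻) refl)
  slot-α (A i) 2F = cong (λ b → if b then 2F else 3F) (dec-true (i ≟ i) refl)
  slot-α (A i) 3F = cong (λ b → if b then 2F else 3F) (dec-false (i ⁺ ≟ i) (⁺-≢ 1≤K i))
  slot-α (A i) 4F = cong (λ b → if b then 1F else 4F) (dec-false (i ⁺ ≟ i ⁻) (≢-sym (⁻-≢-⁺ 2≤K i)))
  slot-α (B j) 0F = refl
  slot-α (B j) 1F = cong (λ b → if b then 1F else 4F) (dec-true (j ⁺ ≟ j ⁺) refl)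
  slot-α (B j) 2F = cong (λ b → if b then 2F else 3F) (dec-true (j ≟ j) refl)
  slot-α (B j) 3F = cong (λ b → if b then 2F else 3F) (dec-false (j ⁻ ≟ j) (⁻-≢ 1≤K j))
  slot-α (B j) 4F = cong (λ b → if b then 1F else 4F) (dec-false (j ⁻ ≟ j ⁺) (⁻-≢-⁺ 2≤K j))

  triangular : ∀ x → iter (σ ∘ α) 3 x ≡ x
  triangular (N   , j)  = cong (N ,_) (⁻⁺ j)
  triangular (S   , j)  = cong (S ,_) (⁺⁻ j)
  triangular (A i , 0F) = cong (λ i → A i , 0F) (⁺⁻ i)
  triangular (A i , 1F) = cong (λ i → A i , 1F) (⁻⁺ i)
  triangular (A i , 2F) = cong (λ i → A i , 2F) (⁻⁺ i)
  triangular (A i , 3F) = cong (λ i → A i , 3F) (⁺⁻ i)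
  triangular (A i , 4F) = cong (λ i → A i , 4F) (⁺⁻ i)
  triangular (B j , 0F) = cong (λ j → B j , 0F) (⁻⁺ j)
  triangular (B j , 1F) = cong (λ j → B j , 1F) (⁺⁻ j)
  triangular (B j , 2F) = cong (λ j → B j , 2F) (⁺⁻ j)
  triangular (B j , 3F) = cong (λ j → B j , 3F) (⁻⁺ j)
  triangular (B j , 4F) = cong (λ j → B j , 4F) (⁻⁺ j)

  reaches-N : ∀ v → TransClosure _~_ v N
  reaches-N N     = (zero , refl) ∷ [ 0F , refl ]
  reaches-N S     = (zero , refl) ∷ (2F , refl) ∷ [ 0F , refl ]
  reaches-N (A i) = [ 0F , refl ]
  reaches-N (B j) = (2F , refl) ∷ [ 0F , refl ]

  isTriangulation : IsTriangulation
  isTriangulation = record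
    { ρ-injective         = λ where
        N     → ⁺-injective
        S     → ⁻-injective
        (A _) → ℤ₅.⁺-injective
        (B _) → ℤ₅.⁺-injective
    ; ρ-cyclic            = λ where
        N     → ⁺-cyclic
        S     → ⁻-cyclic
        (A _) → ℤ₅.⁺-cyclic
        (B _) → ℤ₅.⁺-cyclic
    ; α-involutive        = α-involutive
    ; loopless            = loopless
    ; neighbour-injective = λ v → strictlyInverseʳ⇒injective (slot v) (slot-α v)
    ; triangular          = triangular
    ; hub                 = N
    ; hub-reachable       = reaches-N
    }

  toFin : Vertex → Fin (2 + (k + k))
  toFin N     = 0F
  toFin S     = 1F
  toFin (A i) = suc (suc (i ↑ˡ k))
  toFin (B j) = suc (suc (k ↑ʳ j))

  fromFin : Fin (2 + (k + k)) → Vertex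
  fromFin 0F            = N
  fromFin 1F            = S
  fromFin (suc (suc i)) = [ A , B ]′ (splitAt k i)

  toFin-fromFin : ∀ i → toFin (fromFin i) ≡ i
  toFin-fromFin 0F            = refl
  toFin-fromFin 1F            = refl
  toFin-fromFin (suc (suc i)) with splitAt k i in eq
  ... | inj₁ j = cong (λ (i : Fin (k + k)) → suc (suc i)) (splitAt⁻¹-↑ˡ {m = k} eq)
  ... | inj₂ j = cong (λ (i : Fin (k + k)) → suc (suc i)) (splitAt⁻¹-↑ʳ {m = k} eq)

  fromFin-toFin : ∀ v → fromFin (toFin v) ≡ v
  fromFin-toFin N     = refl
  fromFin-toFin S     = refl
  fromFin-toFin (A i) = cong [ A , B ]′ (splitAt-↑ˡ k i k)
  fromFin-toFin (B j) = cong [ A , B ]′ (splitAt-↑ʳ k k j)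

  enum : Vertex ↔ Fin (2 + (k + k))
  enum = mk↔ₛ′ toFin fromFin toFin-fromFin fromFin-toFin

  degree-sum : sum (deg ∘ fromFin) ≡ 6 * (k + k)
  degree-sum = begin
    k + (k + sum (λ i → deg ([ A , B ]′ (splitAt k i))))  ≡⟨ cong (λ n → k + (k + n)) (sum-cong-≗ (deg-ring ∘ splitAt k)) ⟩
    k + (k + sum {k + k} (λ _ → 5))                       ≡⟨ cong (λ n → k + (k + n)) (sum-const (k + k) 5) ⟩
    k + (k + (k + k) * 5)                                 ≡⟨ collect k ⟩
    6 * (k + k)                                           ∎
    where
      open ≡-Reasoning
      deg-ring : ∀ x → deg ([ A , B ]′ x) ≡ 5
      deg-ring (inj₁ _) = refl
      deg-ring (inj₂ _) = refl
      collect : ∀ k → k + (k + (k + k) * 5) ≡ 6 * (k + k)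
      collect = solve-∀

  open Plane isTriangulation enum degree-sum using (plane; allOddDegree)

  odd-bipyramid : k % 2 ≡ 1 → Σ (PlaneTriangulation (2 + (k + k))) AllOddDegree
  odd-bipyramid k-odd = plane , allOddDegree λ where
    N     → k-odd
    S     → k-odd
    (A _) → refl
    (B _) → refl

proposition38 : (q : ℕ) → Σ (PlaneTriangulation (4 * suc q)) AllOddDegree
proposition38 zero    = K₄.k₄
proposition38 (suc p) = subst (λ n → Σ (PlaneTriangulation n) AllOddDegree) (vertex-count p) (odd-bipyramid k-odd)
  where
    open GyroelongatedBipyramid (suc p * 2) (s≤s (s≤s z≤n))
    k-odd : k % 2 ≡ 1
    k-odd = [m+kn]%n≡m%n 1 (suc p) 2
    vertex-count : ∀ p → 2 + (suc (suc p * 2) + suc (suc p * 2)) ≡ 4 * suc (suc p)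
    vertex-count = solve-∀
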